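{- Let $G$ be a finite simple $2$-edge connected graph and let $v \in V(G)$. If $d(v)$ is odd, then there is a cycle of even length in $G$ containing $v$.
   Context: Graphs are finite, simple (no loops, no multiple edges). $d(v)$ denotes the degree of $v$. A graph is $2$-edge connected if it is connected and remains connected whenever fewer than $2$ edges are removed. The length of a cycle is its number of edges. -}

module Defs where

open import Level using (0ℓ)
open import Data.Nat using (ℕ; suc; _+_; _*_; _≤_)
open import Data.Fin using (Fin)
open import Data.Fin.Properties using () renaming (_≟_ to _≟F_)
open import Data.List using (List; []; _∷_; length; filter; allFin; head; last)
open import Data.List.Membership.Propositional using (_∈_)
open import Data.List.Relation.Unary.Unique.Propositional using (Unique)
open import Data.Maybe using (Maybe; just)
open import Data.Sum using (_⊎_)
open import Data.Product using (Σ; ∃; _×_; _,_)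
open import Relation.Nullary using (¬_; Dec)
open import Relation.Binary.PropositionalEquality using (_≡_)

record Graph : Set₁ where
  field
    n      : ℕ
    Adj    : Fin n → Fin n → Set
    adj?   : (u w : Fin n) → Dec (Adj u w)
    sym    : ∀ {u w} → Adj u w → Adj w u
    irrefl : ∀ {u} → ¬ Adj u u

open Graph public

Vertex : Graph → Set
Vertex G = Fin (n G)

degree : (G : Graph) → Vertex G → ℕ
degree G v = length (filter (adj? G v) (allFin (n G)))

EdgeIs : ∀ {m} → Fin m → Fin m → Fin m → Fin m → Set
EdgeIs a b u w = (u ≡ a × w ≡ b) ⊎ (u ≡ b × w ≡ a)

data Walk {m : ℕ} (R : Fin m → Fin m → Set) : Fin m → Fin m → Set where
  here : ∀ {x} → Walk R x x
  step : ∀ {x y z} → R x y → Walk R y z → Walk R x z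

ConnectedRel : ∀ {m} → (Fin m → Fin m → Set) → Set
ConnectedRel {m} R = (x y : Fin m) → Walk R x y

Connected : Graph → Set
Connected G = (1 ≤ n G) × ConnectedRel (Adj G)

AdjMinus : (G : Graph) → Vertex G → Vertex G → Vertex G → Vertex G → Set
AdjMinus G a b u w = Adj G u w × ¬ EdgeIs a b u w

-- 2-edge connected: connected, and stays connected after removing any
-- single edge (removing 0 edges is covered by connectedness).
TwoEdgeConnected : Graph → Set
TwoEdgeConnected G =
  Connected G × (∀ a b → Adj G a b → ConnectedRel (AdjMinus G a b))

data Path {m : ℕ} (R : Fin m → Fin m → Set) : List (Fin m) → Set where
  one  : ∀ {x} → Path R (x ∷ [])
  cons : ∀ {x y xs} → R x y → Path R (y ∷ xs) → Path R (x ∷ y ∷ xs)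

-- Its length (number of edges) is k = length of the list.
IsCycle : (G : Graph) → List (Vertex G) → Set
IsCycle G cs =
  3 ≤ length cs × Unique cs × Path (Adj G) cs ×
  (∃ λ x → ∃ λ y → head cs ≡ just x × last cs ≡ just y × Adj G y x)

Even : ℕ → Set
Even k = ∃ λ j → k ≡ 2 * j

Odd : ℕ → Set
Odd k = ∃ λ j → k ≡ 1 + 2 * j

-- Since no edge vu is a bridge, every neighbour u of v reaches another
-- neighbour p(u) of v in G − v. If p were an involution on the neighbourhood it
-- would pair the neighbours off and d(v) would be even; so some neighbour a has
-- c = p(a) and b = p(c) with a, b, c pairwise distinct. Run a simple path from
-- c to b until it first meets a simple a–b path, at t. The legs a–t, t–b, c–t
-- are internally disjoint and pair up into paths a–b, a–c, c–b in G − v whose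
-- lengths add up to twice the total length of the legs, so one of them has even
-- length, and v closes it into an even cycle.
module Submission where

open import Defs
open import Data.Empty using (⊥; ⊥-elim)
open import Data.Fin using (Fin)
open import Data.Fin.Properties using (_≟_)
open import Data.List using (List; []; _∷_; _++_; _∷ʳ_; [_]; length; reverse; last; filter; allFin)
open import Data.List.Membership.Propositional using (_∈_; _∉_; find; lose)
open import Data.List.Membership.Propositional.Properties
  using (∈-++⁻; ∈-++⁺ˡ; ∈-++⁺ʳ; ∈-∃++; ∈-filter⁺; ∈-filter⁻; ∈-allFin)
open import Data.List.Properties using (length-++; length-reverse; reverse-++; ∷ʳ-++; unfold-reverse)
open import Data.List.Relation.Binary.Disjoint.Propositional using (Disjoint)
open import Data.List.Relation.Unary.All as All using (All; []; _∷_)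
open import Data.List.Relation.Unary.All.Properties using (++⁻ˡ; ¬Any⇒All¬; All¬⇒¬Any; ¬All⇒Any¬)
import Data.List.Relation.Unary.AllPairs as AllPairs
open AllPairs using ([]; _∷_)
open import Data.List.Relation.Unary.Any using (Any; here; there)
open import Data.List.Relation.Unary.Any.Properties using (reverse⁻)
import Data.List.Relation.Unary.First as First
open First using (FirstView; first)
open import Data.List.Relation.Unary.First.Properties using (toView)
open import Data.List.Relation.Unary.Unique.Propositional using (Unique)
import Data.List.Relation.Unary.Unique.Propositional.Properties as Unique
open import Data.Maybe using (just)
open import Data.Nat using (ℕ; zero; suc; _+_; _≤_; z≤n; s≤s; parity)
open import Data.Nat.Properties using (*-suc; even≢odd; suc-injective)
open import Data.Parity using (Parity; 0ℙ; 1ℙ; _⁻¹) renaming (_+_ to _⊕_)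
open import Data.Parity.Properties using (+-homo-+; p+p⁻¹≡1ℙ)
open import Data.Product using (Σ; ∃; _×_; _,_; proj₁; proj₂; map₁; map₂)
open import Data.Sum using (_⊎_; inj₁; inj₂; [_,_]′; swap) renaming (map to ⊎-map)
open import Function using (_∘_)
open import Relation.Nullary using (Dec; yes; no)
open import Relation.Nullary.Decidable using (toSum)
open import Relation.Unary using (Decidable; ∁)
import Relation.Binary.PropositionalEquality as ≡
open ≡ using (_≡_; _≢_; refl; cong; subst; setoid; module ≡-Reasoning)

Even-2+ : ∀ {k} → Even k → Even (2 + k)
Even-2+ (j , refl) = suc j , ≡.sym (*-suc 2 j)

parity≡1ℙ⇒Even-suc : ∀ k → parity k ≡ 1ℙ → Even (suc k)
parity≡1ℙ⇒Even-suc zero ()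
parity≡1ℙ⇒Even-suc (suc zero) _ = 1 , refl
parity≡1ℙ⇒Even-suc (suc (suc k)) p = Even-2+ (parity≡1ℙ⇒Even-suc k p)

¬Even×Odd : ∀ {k} → Even k → Odd k → ⊥
¬Even×Odd (i , refl) (j , e) = even≢odd i j e

parity-+-suc≡1ℙ : ∀ k l → parity k ≡ parity l → parity (k + suc l) ≡ 1ℙ
parity-+-suc≡1ℙ k l eq = begin
  parity (k + suc l)              ≡⟨ +-homo-+ k (suc l) ⟩
  parity k ⊕ parity (suc l)       ≡⟨ cong (_⊕ parity (suc l)) eq ⟩
  parity l ⊕ parity (suc l)       ≡⟨ cong (parity l ⊕_) (+-homo-+ 1 l) ⟩
  parity l ⊕ parity l ⁻¹          ≡⟨ p+p⁻¹≡1ℙ (parity l) ⟩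
  1ℙ                              ∎
  where open ≡-Reasoning

parity-pigeonhole : ∀ (p q s : Parity) → p ≡ s ⊎ p ≡ q ⊎ q ≡ s
parity-pigeonhole 0ℙ 0ℙ _  = inj₂ (inj₁ refl)
parity-pigeonhole 1ℙ 1ℙ _  = inj₂ (inj₁ refl)
parity-pigeonhole 0ℙ 1ℙ 0ℙ = inj₁ refl
parity-pigeonhole 0ℙ 1ℙ 1ℙ = inj₂ (inj₂ refl)
parity-pigeonhole 1ℙ 0ℙ 0ℙ = inj₂ (inj₂ refl)
parity-pigeonhole 1ℙ 0ℙ 1ℙ = inj₁ refl

one-of-three-odd : ∀ p q s →
  parity (p + suc s) ≡ 1ℙ ⊎ parity (p + suc q) ≡ 1ℙ ⊎ parity (q + suc s) ≡ 1ℙ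
one-of-three-odd p q s =
  ⊎-map (parity-+-suc≡1ℙ p s) (⊎-map (parity-+-suc≡1ℙ p q) (parity-+-suc≡1ℙ q s))
    (parity-pigeonhole (parity p) (parity q) (parity s))

module _ {A : Set} where
  open import Data.List.Relation.Binary.Permutation.Setoid (setoid A) using (_↭_; ↭-sym)
  open import Data.List.Relation.Binary.Permutation.Setoid.Properties (setoid A)
    using (↭-shift; ↭-reverse; ∈-resp-↭; Unique-resp-↭; xs↭ys⇒|xs|≡|ys|)

  Unique-++⁻ : ∀ xs {ys : List A} → Unique (xs ++ ys) → Unique xs × Unique ys
  Unique-++⁻ []       u         = [] , u
  Unique-++⁻ (x ∷ xs) (x∉ ∷ u) = (++⁻ˡ xs x∉ ∷ proj₁ (Unique-++⁻ xs u)) , proj₂ (Unique-++⁻ xs u)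

  Unique-split : ∀ xs {m : A} {ys} → Unique (xs ++ m ∷ ys) → Unique (xs ∷ʳ m) × Unique (m ∷ ys)
  Unique-split xs {m} {ys} u =
    proj₁ (Unique-++⁻ (xs ∷ʳ m) (subst Unique (≡.sym (∷ʳ-++ xs m ys)) u)) ,
    proj₂ (Unique-++⁻ xs u)

  Unique-join : ∀ xs {m : A} {ys} → Unique (xs ∷ʳ m) → Unique (m ∷ ys) → Disjoint xs ys →
    Unique (xs ++ m ∷ ys)
  Unique-join xs {m} {ys} uxs (m∉ys ∷ uys) xs#ys =
    subst Unique (∷ʳ-++ xs m ys) (Unique.++⁺ uxs uys disjoint)
    where
    disjoint : Disjoint (xs ∷ʳ m) ys
    disjoint (z∈xs∷ʳm , z∈ys) with ∈-++⁻ xs z∈xs∷ʳm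
    ... | inj₁ z∈xs          = xs#ys (z∈xs , z∈ys)
    ... | inj₂ (here refl)   = All.lookup m∉ys z∈ys refl

  Unique-reverse : ∀ {xs : List A} → Unique xs → Unique (reverse xs)
  Unique-reverse {xs} = Unique-resp-↭ (↭-sym (↭-reverse xs))

  record FixedPointFreeInvolution (f : A → A) (L : List A) : Set where
    field
      closed         : ∀ {x} → x ∈ L → f x ∈ L
      fixedPointFree : ∀ {x} → x ∈ L → f x ≢ x
      involutive     : ∀ {x} → x ∈ L → f (f x) ≡ x

  module _ {f : A → A} where
    open FixedPointFreeInvolution

    image-of-head∈tail : ∀ {x L} → FixedPointFreeInvolution f (x ∷ L) → f x ∈ L
    image-of-head∈tail ι with closed ι (here refl)
    ... | here fx≡x  = ⊥-elim (fixedPointFree ι (here refl) fx≡x)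
    ... | there fx∈L = fx∈L

    -- The orbit {x, f x} is removed by moving f x to the front of the tail.
    remove-orbit : ∀ {x L} → Unique (x ∷ L) → FixedPointFreeInvolution f (x ∷ L) →
      ∃ λ L′ → length L ≡ suc (length L′) × Unique L′ × FixedPointFreeInvolution f L′
    remove-orbit {x} {L} (x∉L ∷ uL) ι
      with pre , suf , refl ← ∈-∃++ (image-of-head∈tail ι)
      = L′ , xs↭ys⇒|xs|≡|ys| σ , uL′ , record
          { closed = closed′ ; fixedPointFree = fixedPointFree ι ∘ there ∘ ∈L
          ; involutive = involutive ι ∘ there ∘ ∈L }
      where
      L′ : List A
      L′ = pre ++ suf
      σ : L ↭ f x ∷ L′
      σ = ↭-shift pre suf
      u-fx∷L′ : Unique (f x ∷ L′)
      u-fx∷L′ = Unique-resp-↭ σ uL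
      fx∉L′ : All (f x ≢_) L′
      fx∉L′ = AllPairs.head u-fx∷L′
      uL′ : Unique L′
      uL′ = AllPairs.tail u-fx∷L′
      ∈L : ∀ {y} → y ∈ L′ → y ∈ L
      ∈L = ∈-resp-↭ (↭-sym σ) ∘ there
      closed′ : ∀ {y} → y ∈ L′ → f y ∈ L′
      closed′ {y} y∈L′ with closed ι (there (∈L y∈L′))
      ... | here refl = ⊥-elim (All.lookup fx∉L′ y∈L′ (involutive ι (there (∈L y∈L′))))
      ... | there fy∈L with ∈-resp-↭ σ fy∈L
      ...   | there fy∈L′ = fy∈L′
      ...   | here fy≡fx = ⊥-elim (All.lookup x∉L (∈L y∈L′) (begin
                x            ≡⟨ involutive ι (here refl) ⟨
                f (f x)      ≡⟨ cong f fy≡fx ⟨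
                f (f y)      ≡⟨ involutive ι (there (∈L y∈L′)) ⟩
                y            ∎))
        where open ≡-Reasoning

    FixedPointFreeInvolution⇒Even : ∀ {L} → Unique L → FixedPointFreeInvolution f L → Even (length L)
    FixedPointFreeInvolution⇒Even = go _ refl
      where
      go : ∀ k {L} → length L ≡ k → Unique L → FixedPointFreeInvolution f L → Even (length L)
      go zero          {[]}        _   _ _ = 0 , refl
      go (suc zero)    {_ ∷ []}    _   _ ι with image-of-head∈tail ι
      ... | ()
      go (suc (suc k)) {x ∷ L}     len u ι
        with L′ , |L|≡1+|L′| , uL′ , ιL′ ← remove-orbit u ι
        = subst (Even ∘ suc) (≡.sym |L|≡1+|L′|)
            (Even-2+ (go k (suc-injective (≡.trans (≡.sym |L|≡1+|L′|) (suc-injective len))) uL′ ιL′))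

firstView : ∀ {A : Set} {P : A → Set} {xs} → Decidable P → Any P xs → FirstView (∁ P) P xs
firstView {xs = xs} P? pxs with first (swap ∘ toSum ∘ P?) xs
... | inj₁ firstP = toView firstP
... | inj₂ none   = ⊥-elim (All¬⇒¬Any none pxs)

data Route {A : Set} (R : A → A → Set) : A → A → List A → Set where
  end : ∀ {x} → Route R x x [ x ]
  _▹_ : ∀ {x y z xs} → R x y → Route R y z xs → Route R x z (x ∷ xs)

infixr 5 _▹_

module _ {A : Set} {R : A → A → Set} where

  route-end∈ : ∀ {x y xs} → Route R x y xs → y ∈ xs
  route-end∈ end     = here refl
  route-end∈ (_ ▹ ρ) = there (route-end∈ ρ)

  route-last : ∀ {x y xs} → Route R x y xs → ∀ w → last (w ∷ xs) ≡ just y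
  route-last end             _ = refl
  route-last {x} (_ ▹ ρ)     _ = route-last ρ x

  route-≢⇒2≤length : ∀ {x y xs} → Route R x y xs → x ≢ y → 2 ≤ length xs
  route-≢⇒2≤length end           x≢y = ⊥-elim (x≢y refl)
  route-≢⇒2≤length (_ ▹ end)     _   = s≤s (s≤s z≤n)
  route-≢⇒2≤length (_ ▹ _ ▹ _)   _   = s≤s (s≤s z≤n)

  route-split : ∀ pre {x z m suf} → Route R x z (pre ++ m ∷ suf) →
    Route R x m (pre ∷ʳ m) × Route R m z (m ∷ suf)
  route-split []            end     = end , end
  route-split []            (r ▹ ρ) = end , r ▹ ρ
  route-split (_ ∷ [])      (r ▹ ρ) = map₁ (r ▹_) (route-split [] ρ)
  route-split (_ ∷ p ∷ pre) (r ▹ ρ) = map₁ (r ▹_) (route-split (p ∷ pre) ρ)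

  route-join : ∀ pre {x z m suf} → Route R x m (pre ∷ʳ m) → Route R m z (m ∷ suf) →
    Route R x z (pre ++ m ∷ suf)
  route-join []            end     σ = σ
  route-join (_ ∷ [])      (r ▹ ρ) σ = r ▹ route-join [] ρ σ
  route-join (_ ∷ p ∷ pre) (r ▹ ρ) σ = r ▹ route-join (p ∷ pre) ρ σ

  route-snoc : ∀ {x y z xs} → Route R x y xs → R y z → Route R x z (xs ∷ʳ z)
  route-snoc end     r = r ▹ end
  route-snoc (r ▹ ρ) s = r ▹ route-snoc ρ s

  route-reverse : (∀ {a b} → R a b → R b a) → ∀ {x y xs} → Route R x y xs → Route R y x (reverse xs)
  route-reverse R-sym end = end
  route-reverse R-sym (_▹_ {x = x} {xs = xs} r ρ) =
    subst (Route R _ x) (≡.sym (unfold-reverse x xs)) (route-snoc (route-reverse R-sym ρ) (R-sym r))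

  record SimplePath (x y : A) : Set where
    constructor simplePath
    field
      vertices : List A
      route    : Route R x y vertices
      unique   : Unique vertices

  SimplePath-from : ∀ {x y z xs} → x ∈ xs → Route R y z xs → Unique xs → SimplePath x z
  SimplePath-from x∈xs ρ u with pre , suf , refl ← ∈-∃++ x∈xs =
    simplePath _ (proj₂ (route-split pre ρ)) (proj₂ (Unique-split pre u))

  -- An odd number of vertices, i.e. an even number of edges.
  EvenSimplePath : A → A → Set
  EvenSimplePath x y = Σ (SimplePath x y) λ P → parity (length (SimplePath.vertices P)) ≡ 1ℙ

walk-++ : ∀ {m} {R : Fin m → Fin m → Set} {x y z} → Walk R x y → Walk R y z → Walk R x z
walk-++ here       τ = τ
walk-++ (step r ω) τ = step r (walk-++ ω τ)

walk-map : ∀ {m} {R S : Fin m → Fin m → Set} → (∀ {a b} → R a b → S a b) →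
  ∀ {x y} → Walk R x y → Walk S x y
walk-map f here       = here
walk-map f (step r ω) = step (f r) (walk-map f ω)

module _ {m : ℕ} {R : Fin m → Fin m → Set} where
  open import Data.List.Membership.DecPropositional (_≟_ {m}) using (_∈?_)

  walk⇒SimplePath : ∀ {x y} → Walk R x y → SimplePath {R = R} x y
  walk⇒SimplePath here = simplePath _ end ([] ∷ [])
  walk⇒SimplePath (step {x = x} r ω) with walk⇒SimplePath ω
  ... | simplePath ys ρ u with x ∈? ys
  ...   | yes x∈ys = SimplePath-from x∈ys ρ u
  ...   | no  x∉ys = simplePath (x ∷ ys) (r ▹ ρ) (¬Any⇒All¬ ys x∉ys ∷ u)

  -- Q runs into P at t; the three legs a–t, t–b (along P) and c–t (along Q)
  -- meet only at t, and any two of them form a simple path.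
  evenSimplePath-of-three : (∀ {a b} → R a b → R b a) → ∀ {a b c} →
    SimplePath a b → SimplePath c b →
    EvenSimplePath {R = R} a b ⊎ EvenSimplePath a c ⊎ EvenSimplePath c b
  evenSimplePath-of-three R-sym {a} {b} {c} P@(simplePath ps ρ u) (simplePath qs σ w)
    with firstView (_∈? ps) (lose (route-end∈ σ) (route-end∈ ρ))
  ... | First._++_∷_ {xs = q₀} {y = t} q₀∉ps t∈ps rest
    with pre , suf , refl ← ∈-∃++ t∈ps
    with ρ₁ , ρ₂ ← route-split pre ρ | u₁ , u₂ ← Unique-split pre u
       | σ₁ , _ ← route-split q₀ σ | w₁ , _ ← Unique-split q₀ w
    = ⊎-map (P ,_) (⊎-map (P₂ ,_) (P₃ ,_)) lengths
    where
    q₀#ps : ∀ {z} → z ∈ q₀ → z ∉ pre ++ t ∷ suf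
    q₀#ps = All.lookup q₀∉ps
    P₂ : SimplePath a c
    P₂ = simplePath (pre ++ t ∷ reverse q₀)
      (route-join pre ρ₁ (subst (Route R t _) (reverse-++ q₀ [ t ]) (route-reverse R-sym σ₁)))
      (Unique-join pre u₁ (subst Unique (reverse-++ q₀ [ t ]) (Unique-reverse w₁))
        λ (z∈pre , z∈q₀ʳ) → q₀#ps (reverse⁻ z∈q₀ʳ) (∈-++⁺ˡ z∈pre))
    P₃ : SimplePath c b
    P₃ = simplePath (q₀ ++ t ∷ suf) (route-join q₀ σ₁ ρ₂)
      (Unique-join q₀ w₁ u₂ λ (z∈q₀ , z∈suf) → q₀#ps z∈q₀ (∈-++⁺ʳ pre (there z∈suf)))
    lengths : parity (length (pre ++ t ∷ suf)) ≡ 1ℙ ⊎ parity (length (pre ++ t ∷ reverse q₀)) ≡ 1ℙ ⊎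
              parity (length (q₀ ++ t ∷ suf)) ≡ 1ℙ
    lengths rewrite length-++ pre {t ∷ suf} | length-++ pre {t ∷ reverse q₀} | length-reverse q₀
                  | length-++ q₀ {t ∷ suf}
      = one-of-three-odd (length pre) (length q₀) (length suf)

Avoiding : ∀ {m} → Fin m → (Fin m → Fin m → Set) → Fin m → Fin m → Set
Avoiding v S a b = S a b × a ≢ v × b ≢ v

Avoiding-sym : ∀ {m} {v : Fin m} {S : Fin m → Fin m → Set} → (∀ {a b} → S a b → S b a) →
  ∀ {a b} → Avoiding v S a b → Avoiding v S b a
Avoiding-sym S-sym (s , a≢v , b≢v) = S-sym s , b≢v , a≢v

route-avoids : ∀ {m} {v : Fin m} {S : Fin m → Fin m → Set} {x y xs} → x ≢ v →
  Route (Avoiding v S) x y xs → All (v ≢_) xs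
route-avoids x≢v end                 = (x≢v ∘ ≡.sym) ∷ []
route-avoids x≢v ((_ , _ , y≢v) ▹ ρ) = (x≢v ∘ ≡.sym) ∷ route-avoids y≢v ρ

first-arrival : ∀ {m} {v : Fin m} {S : Fin m → Fin m → Set} {x} → Walk S x v → x ≢ v →
  ∃ λ w → S w v × Walk (Avoiding v S) x w
first-arrival here x≢v = ⊥-elim (x≢v refl)
first-arrival {v = v} (step {y = y} s ω) x≢v with y ≟ v
... | yes refl = _ , s , here
... | no  y≢v  = map₂ (map₂ (step (s , x≢v , y≢v))) (first-arrival ω y≢v)

module _ (G : Graph) (v : Vertex G) where

  EvenCycleThrough : Set
  EvenCycleThrough = Σ (List (Vertex G)) (λ C → IsCycle G C × Even (length C) × v ∈ C)

  neighbour≢ : ∀ {u} → Adj G v u → u ≢ v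
  neighbour≢ vu refl = irrefl G vu

  Path-cons-route : ∀ {S : Vertex G → Vertex G → Set} → (∀ {a b} → S a b → Adj G a b) →
    ∀ {w x y xs} → Adj G w x → Route S x y xs → Path (Adj G) (w ∷ xs)
  Path-cons-route f wx end     = cons wx one
  Path-cons-route f wx (s ▹ ρ) = cons wx (Path-cons-route f (f s) ρ)

  close-cycle : ∀ {x y} → x ≢ y → Adj G v x → Adj G v y →
    EvenSimplePath {R = Avoiding v (Adj G)} x y → EvenCycleThrough
  close-cycle {y = y} x≢y vx vy (simplePath xs ρ u , odd) =
    v ∷ xs ,
    (s≤s (route-≢⇒2≤length ρ x≢y) , route-avoids (neighbour≢ vx) ρ ∷ u ,
      Path-cons-route proj₁ vx ρ , v , y , refl , route-last ρ v , Graph.sym G vy) ,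
    parity≡1ℙ⇒Even-suc (length xs) odd , here refl

  another-neighbour : TwoEdgeConnected G → ∀ {u} → Adj G v u →
    ∃ λ w → Adj G v w × w ≢ u × Walk (Avoiding v (Adj G)) u w
  another-neighbour (_ , bridgeless) {u} vu
    with w , (wv , wv≢vu) , ω ← first-arrival (bridgeless v u vu u v) (neighbour≢ vu)
    = w , Graph.sym G wv , (λ { refl → wv≢vu (inj₂ (refl , refl)) }) , walk-map (map₁ proj₁) ω

  evenCycle-of-three-neighbours : ∀ {a b c} → Adj G v a → Adj G v b → Adj G v c →
    a ≢ b → a ≢ c → c ≢ b →
    Walk (Avoiding v (Adj G)) a c → Walk (Avoiding v (Adj G)) c b → EvenCycleThrough
  evenCycle-of-three-neighbours va vb vc a≢b a≢c c≢b ac cb =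
    [ close-cycle a≢b va vb , [ close-cycle a≢c va vc , close-cycle c≢b vc vb ]′ ]′
      (evenSimplePath-of-three (Avoiding-sym (Graph.sym G))
        (walk⇒SimplePath (walk-++ ac cb)) (walk⇒SimplePath cb))

  module Partner (tec : TwoEdgeConnected G) where

    -- Off the neighbourhood of v the partner is junk (the identity).
    partner : Vertex G → Vertex G
    partner u with adj? G v u
    ... | yes vu = proj₁ (another-neighbour tec vu)
    ... | no  _  = u

    partner-spec : ∀ {u} → Adj G v u →
      Adj G v (partner u) × partner u ≢ u × Walk (Avoiding v (Adj G)) u (partner u)
    partner-spec {u} vu with adj? G v u
    ... | yes vu′ = proj₂ (another-neighbour tec vu′)
    ... | no ¬vu  = ⊥-elim (¬vu vu)

    neighbours : List (Vertex G)
    neighbours = filter (adj? G v) (allFin (n G))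

    adjacent : ∀ {u} → u ∈ neighbours → Adj G v u
    adjacent u∈ = proj₂ (∈-filter⁻ (adj? G v) {xs = allFin (n G)} u∈)

    involutive? : (u : Vertex G) → Dec (partner (partner u) ≡ u)
    involutive? u = partner (partner u) ≟ u

    partner-not-involutive : Odd (degree G v) → ∃ λ u → Adj G v u × partner (partner u) ≢ u
    partner-not-involutive odd with All.all? involutive? neighbours
    ... | yes involutive = ⊥-elim (¬Even×Odd (FixedPointFreeInvolution⇒Even unique ι) odd)
      where
      unique : Unique neighbours
      unique = Unique.filter⁺ (adj? G v) (Unique.allFin⁺ (n G))
      ι : FixedPointFreeInvolution partner neighbours
      ι = record
        { closed         = λ u∈ → ∈-filter⁺ (adj? G v) (∈-allFin _) (proj₁ (partner-spec (adjacent u∈)))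
        ; fixedPointFree = proj₁ ∘ proj₂ ∘ partner-spec ∘ adjacent
        ; involutive     = All.lookup involutive }
    ... | no ¬involutive with u , u∈ , ¬inv ← find (¬All⇒Any¬ involutive? neighbours ¬involutive)
      = u , adjacent u∈ , ¬inv

    evenCycle : Odd (degree G v) → EvenCycleThrough
    evenCycle odd
      with a , va , ¬involutive ← partner-not-involutive odd
      with vc , c≢a , ac ← partner-spec va
      with vb , b≢c , cb ← partner-spec vc
      = evenCycle-of-three-neighbours va vb vc (¬involutive ∘ ≡.sym) (c≢a ∘ ≡.sym) (b≢c ∘ ≡.sym) ac cb

theorem5 : (G : Graph) → TwoEdgeConnected G → (v : Vertex G) →
    Odd (degree G v) →
    Σ (List (Vertex G)) (λ C → IsCycle G C × Even (length C) × v ∈ C)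
theorem5 G tec v = Partner.evenCycle G v tec
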